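{- The Veblen points of a Steiner triple system $\mathcal{S}$ of order $v$ form a normal subsystem of $\mathcal{S}$ of order $2^{n+1}-1\le v$ (for some integer $n$), which is isomorphic to $\mathrm{PG}(n,2)$.
   Context: A Steiner triple system (STS) of order $v$ is a set $\mathcal{S}$ of $v$ points with a family of 3-subsets (triples) such that every 2-subset lies in exactly one triple. Its Steiner loop $\mathcal{L_S}=\mathcal{S}\cup\{\Omega\}$ has product: for distinct $x,y\in\mathcal{S}$, $xy$ is the third point of their triple; $xx=\Omega$; $x\Omega=\Omega x=x$. A subsystem $\mathcal{N}$ is normal if $\mathcal{N}\cup\{\Omega\}$ is a normal subloop of $\mathcal{L_S}$. A point $x$ is a Veblen point if whenever $\{x,a,b\},\{x,c,d\},\{y,a,c\}$ are triples, also $\{y,b,d\}$ is a triple. $\mathrm{PG}(n,2)$ denotes the STS formed by the points and lines of the projective space of dimension $n$ over $\mathrm{GF}(2)$. -}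

module Defs where

open import Data.Nat using (ℕ; _^_; _∸_; _≤_)
open import Data.Fin using (Fin; _≟_)
open import Data.Bool using (Bool; true; false; T; _∨_; _xor_)
open import Data.Vec using (Vec; foldr; zipWith)
open import Data.Maybe using (Maybe; just; nothing)
open import Data.Product using (Σ; ∃; _×_; _,_; proj₁)
open import Data.Unit using (⊤)
open import Relation.Nullary using (¬_; yes; no)
open import Relation.Binary.PropositionalEquality using (_≡_; _≢_)
open import Function.Bundles using (_⇔_)

-- The family of triples is given by its (decidable) membership predicate
-- Triple x y z ≡ true  ⇔  {x,y,z} is a triple; it is symmetric, the three
-- points are distinct, and every 2-subset lies in exactly one triple.

record STS (v : ℕ) : Set where
  field
    Triple    : Fin v → Fin v → Fin v → Bool
    distinct  : ∀ {x y z} → Triple x y z ≡ true → x ≢ y × y ≢ z × x ≢ z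
    sym₁₂     : ∀ {x y z} → Triple x y z ≡ true → Triple y x z ≡ true
    sym₂₃     : ∀ {x y z} → Triple x y z ≡ true → Triple x z y ≡ true
    third     : ∀ x y → x ≢ y → Σ (Fin v) (λ z → Triple x y z ≡ true)
    unique    : ∀ {x y z w} → Triple x y z ≡ true → Triple x y w ≡ true → z ≡ w

module _ {v : ℕ} (S : STS v) where
  open STS S

  IsTriple : Fin v → Fin v → Fin v → Set
  IsTriple x y z = Triple x y z ≡ true

  Loop : Set
  Loop = Maybe (Fin v)

  Ω : Loop
  Ω = nothing

  _·_ : Loop → Loop → Loop
  nothing · b = b
  just x · nothing = just x
  just x · just y with x ≟ y
  ... | yes _ = nothing
  ... | no x≢y = just (proj₁ (third x y x≢y))

  withΩ : (Fin v → Set) → Loop → Set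
  withΩ N nothing = ⊤
  withΩ N (just x) = N x

  IsSubsystem : (Fin v → Set) → Set
  IsSubsystem N = ∀ x y z → N x → N y → IsTriple x y z → N z

  -- Subloop (H contains Ω, closed under the product; in a Steiner loop
  -- left and right divisions coincide with the product: a\b = b/a = ab).
  IsSubloop : (Loop → Set) → Set
  IsSubloop H = H Ω × (∀ a b → H a → H b → H (a · b))

  -- Normal subloop (Bruck): xH = Hx, x(yH) = (xy)H, (Hx)y = H(xy).
  IsNormalSubloop : (Loop → Set) → Set
  IsNormalSubloop H =
    IsSubloop H ×
    (∀ x y z →
       ((∃ λ h → H h × z ≡ x · h) ⇔ (∃ λ h → H h × z ≡ h · x)) ×
       ((∃ λ h → H h × z ≡ x · (y · h)) ⇔ (∃ λ h → H h × z ≡ (x · y) · h)) ×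
       ((∃ λ h → H h × z ≡ (h · x) · y) ⇔ (∃ λ h → H h × z ≡ h · (x · y))))

  IsNormalSubsystem : (Fin v → Set) → Set
  IsNormalSubsystem N = IsSubsystem N × IsNormalSubloop (withΩ N)

  Veblen : Fin v → Set
  Veblen x = ∀ y a b c d → IsTriple x a b → IsTriple x c d → IsTriple y a c →
             IsTriple y b d

-- PG(m-1, 2): points are the nonzero vectors of GF(2)^m, lines are the
-- triples {p, q, p+q} with p ≠ q.  (m = 0 gives the empty system PG(-1,2).)

PGPoint : ℕ → Set
PGPoint m = Σ (Vec Bool m) (λ u → T (foldr _ _∨_ false u))

PGTriple : ∀ {m} → PGPoint m → PGPoint m → PGPoint m → Set
PGTriple p q r = (proj₁ p ≢ proj₁ q) × (proj₁ r ≡ zipWith _xor_ (proj₁ p) (proj₁ q))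

IsoToPG : ∀ {v} (S : STS v) (N : Fin v → Set) (m : ℕ) → Set
IsoToPG {v} S N m =
  Σ (PGPoint m → Fin v) λ f →
    (∀ p q → f p ≡ f q → p ≡ q) ×
    (∀ x → N x ⇔ (∃ λ p → f p ≡ x)) ×
    (∀ p q r → PGTriple p q r ⇔ IsTriple S (f p) (f q) (f r))

HasOrder : ∀ {v} (N : Fin v → Set) (k : ℕ) → Set
HasOrder {v} N k =
  Σ (Fin k → Fin v) λ g →
    (∀ i j → g i ≡ g j → i ≡ j) × (∀ x → N x ⇔ (∃ λ i → g i ≡ x))

{-# OPTIONS --safe #-}
module Submission where

-- A point x is a Veblen point exactly when x lies in the (right) nucleus of
-- the Steiner loop, i.e. (ab)x = a(bx) for all a, b.  The nucleus of a
-- commutative loop is a normal subloop, and here every element has order 2,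
-- so the Veblen points together with Ω form an elementary abelian 2-group:
-- a vector space over GF(2).  A basis of m points (found greedily, adjoining
-- each Veblen point not yet spanned) identifies this group with GF(2)^m,
-- under which the lines {u, w, u + w} of PG(m-1,2) become exactly the
-- triples of S; in particular there are 2^m - 1 Veblen points.

open import Defs
open import Data.Bool using (Bool; true; false; T; _∨_; _xor_)
import Data.Bool as Bool
open import Data.Bool.Properties using (T-irrelevant)
open import Data.Empty using (⊥-elim)
open import Data.Fin as Fin using (Fin; _≟_; punchIn; punchOut)
open import Data.Fin.Properties
  using (2↔Bool; *↔×; punchIn-injective; punchInᵢ≢i; punchIn-punchOut; injective⇒≤; all?)
open import Data.Fin.Subset.Properties using (anySubset?)
open import Data.List using (List; []; _∷_; allFin)
open import Data.List.Membership.Propositional using (_∈_)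
open import Data.List.Membership.Propositional.Properties using (∈-allFin)
open import Data.List.Relation.Unary.Any using (here; there)
open import Data.Maybe using (just; nothing)
open import Data.Maybe.Properties using (just-injective; ≡-dec)
open import Data.Nat using (ℕ; zero; suc; _^_; _∸_; _≤_)
open import Data.Nat.Properties using (m^n>0; m+[n∸m]≡n)
open import Data.Product using (Σ; ∃; _×_; _,_; proj₁; proj₂)
open import Data.Product.Function.NonDependent.Propositional using (_×-↔_)
open import Data.Sum using (_⊎_; inj₁; inj₂)
open import Data.Unit using (tt)
open import Data.Vec using (Vec; []; _∷_; foldr; zipWith; replicate)
open import Data.Vec.Relation.Unary.All using (All; []; _∷_)
open import Function using (_∘_)
open import Function.Bundles using (_⇔_; mk⇔; _↔_; mk↔ₛ′; Inverse; Equivalence)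
open import Function.Properties.Inverse using (↔-trans)
open import Relation.Binary.PropositionalEquality
open import Relation.Nullary using (¬_; Dec; yes; no)
open import Relation.Nullary.Decidable using (_→-dec_)

Nonzero : ∀ {m} → Vec Bool m → Set
Nonzero u = T (foldr _ _∨_ false u)

nonzero⇒≢0 : ∀ {m} (u : Vec Bool m) → Nonzero u → u ≢ replicate m false
nonzero⇒≢0 (true ∷ u) _ ()
nonzero⇒≢0 (false ∷ u) nz refl = nonzero⇒≢0 u nz refl

≢0⇒nonzero : ∀ {m} (u : Vec Bool m) → u ≢ replicate m false → Nonzero u
≢0⇒nonzero [] u≢0 = ⊥-elim (u≢0 refl)
≢0⇒nonzero (true ∷ u) _ = tt
≢0⇒nonzero (false ∷ u) u≢0 = ≢0⇒nonzero u (u≢0 ∘ cong (false ∷_))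

PGPoint-≡ : ∀ {m} {p q : PGPoint m} → proj₁ p ≡ proj₁ q → p ≡ q
PGPoint-≡ {p = u , nz} {q = .u , nz′} refl = cong (u ,_) (T-irrelevant nz nz′)

Fin2^↔Vec : ∀ m → Fin (2 ^ m) ↔ Vec Bool m
Fin2^↔Vec zero =
  mk↔ₛ′ (λ _ → []) (λ _ → Fin.zero) (λ { [] → refl }) (λ { Fin.zero → refl ; (Fin.suc ()) })
Fin2^↔Vec (suc m) = ↔-trans *↔× (↔-trans (2↔Bool ×-↔ Fin2^↔Vec m) ×↔∷)
  where
  ×↔∷ : (Bool × Vec Bool m) ↔ Vec Bool (suc m)
  ×↔∷ = mk↔ₛ′ (λ (b , u) → b ∷ u) (λ { (b ∷ u) → b , u })
              (λ { (b ∷ u) → refl }) (λ { (b , u) → refl })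

enumerate-except : ∀ {A : Set} {k} → Fin (suc k) ↔ A → (a : A) →
  Σ (Fin k → A) λ e →
    (∀ i j → e i ≡ e j → i ≡ j) × (∀ i → e i ≢ a) × (∀ x → x ≢ a → ∃ λ i → e i ≡ x)
enumerate-except {A = A} {k} enum a = e , e-injective , e≢a , e-onto
  where
  open Inverse enum
  e : Fin k → A
  e i = to (punchIn (from a) i)
  e-injective : ∀ i j → e i ≡ e j → i ≡ j
  e-injective i j eq = punchIn-injective (from a) i j
    (trans (sym (strictlyInverseʳ _)) (trans (cong from eq) (strictlyInverseʳ _)))
  e≢a : ∀ i → e i ≢ a
  e≢a i eq = punchInᵢ≢i (from a) i (trans (sym (strictlyInverseʳ _)) (cong from eq))
  e-onto : ∀ x → x ≢ a → ∃ λ i → e i ≡ x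
  e-onto x x≢a = punchOut a≢x , trans (cong to (punchIn-punchOut a≢x)) (strictlyInverseˡ x)
    where
    a≢x : from a ≢ from x
    a≢x eq = x≢a (trans (sym (strictlyInverseˡ x)) (trans (cong to (sym eq)) (strictlyInverseˡ a)))

Fin[1+[2^m∸1]]↔Vec : ∀ m → Fin (suc (2 ^ m ∸ 1)) ↔ Vec Bool m
Fin[1+[2^m∸1]]↔Vec m = subst (λ n → Fin n ↔ Vec Bool m) (sym (m+[n∸m]≡n (m^n>0 2 m))) (Fin2^↔Vec m)

PGPoint-enumeration : ∀ m →
  Σ (Fin (2 ^ m ∸ 1) → PGPoint m) λ e → (∀ i j → e i ≡ e j → i ≡ j) × (∀ p → ∃ λ i → e i ≡ p)
PGPoint-enumeration m with enumerate-except (Fin[1+[2^m∸1]]↔Vec m) (replicate m false)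
... | e , e-injective , e≢0 , e-onto =
  (λ i → e i , ≢0⇒nonzero (e i) (e≢0 i)) ,
  (λ i j → e-injective i j ∘ cong proj₁) ,
  λ (u , nz) → let (i , eᵢ≡u) = e-onto u (nonzero⇒≢0 u nz) in i , PGPoint-≡ eᵢ≡u

IsoToPG⇒HasOrder : ∀ {v} {S : STS v} {N m} → IsoToPG S N m → HasOrder N (2 ^ m ∸ 1)
IsoToPG⇒HasOrder {N = N} {m} (f , f-injective , N⇔image , _)
  with PGPoint-enumeration m
... | e , e-injective , e-onto =
  f ∘ e , (λ i j → e-injective i j ∘ f-injective _ _) , λ x → mk⇔ (enumerated x) (member x)
  where
  open Equivalence
  enumerated : ∀ x → N x → ∃ λ i → f (e i) ≡ x
  enumerated x Nx =
    let (p , fp≡x) = to (N⇔image x) Nx ; (i , eᵢ≡p) = e-onto p in i , trans (cong f eᵢ≡p) fp≡x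
  member : ∀ x → (∃ λ i → f (e i) ≡ x) → N x
  member x (i , eq) = from (N⇔image x) (e i , eq)

HasOrder⇒≤ : ∀ {v} {N : Fin v → Set} {k} → HasOrder N k → k ≤ v
HasOrder⇒≤ (g , g-injective , _) = injective⇒≤ {f = g} (g-injective _ _)

module SteinerLoop {v : ℕ} (S : STS v) where
  open STS S

  infixl 7 _∙_
  _∙_ : Loop S → Loop S → Loop S
  _∙_ = _·_ S

  ∙-identityʳ : ∀ a → a ∙ nothing ≡ a
  ∙-identityʳ nothing = refl
  ∙-identityʳ (just _) = refl

  ∙-selfInverse : ∀ a → a ∙ a ≡ nothing
  ∙-selfInverse nothing = refl
  ∙-selfInverse (just x) with x ≟ x
  ... | yes _ = refl
  ... | no x≢x = ⊥-elim (x≢x refl)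

  triple⇒∙ : ∀ {x y z} → IsTriple S x y z → just x ∙ just y ≡ just z
  triple⇒∙ {x} {y} t with x ≟ y
  ... | yes x≡y = ⊥-elim (proj₁ (distinct t) x≡y)
  ... | no x≢y = cong just (unique (proj₂ (third x y x≢y)) t)

  ∙⇒triple : ∀ {x y z} → just x ∙ just y ≡ just z → IsTriple S x y z
  ∙⇒triple {x} {y} eq with x ≟ y
  ∙⇒triple () | yes _
  ... | no x≢y = subst (IsTriple S x y) (just-injective eq) (proj₂ (third x y x≢y))

  ≡⊎triple : ∀ x y → x ≡ y ⊎ ∃ (IsTriple S x y)
  ≡⊎triple x y with x ≟ y
  ... | yes x≡y = inj₁ x≡y
  ... | no x≢y = inj₂ (third x y x≢y)

  ∙-comm : ∀ a b → a ∙ b ≡ b ∙ a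
  ∙-comm nothing b = sym (∙-identityʳ b)
  ∙-comm (just x) nothing = refl
  ∙-comm (just x) (just y) with ≡⊎triple x y
  ... | inj₁ refl = refl
  ... | inj₂ (z , t) = trans (triple⇒∙ t) (sym (triple⇒∙ (sym₁₂ t)))

  a∙[a∙b]≡b : ∀ a b → a ∙ (a ∙ b) ≡ b
  a∙[a∙b]≡b nothing b = refl
  a∙[a∙b]≡b (just x) nothing = ∙-selfInverse (just x)
  a∙[a∙b]≡b (just x) (just y) with ≡⊎triple x y
  ... | inj₁ refl = cong (just x ∙_) (∙-selfInverse (just x))
  ... | inj₂ (z , t) = trans (cong (just x ∙_) (triple⇒∙ t)) (triple⇒∙ (sym₂₃ t))

  [a∙b]∙b≡a : ∀ a b → (a ∙ b) ∙ b ≡ a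
  [a∙b]∙b≡a a b = trans (∙-comm (a ∙ b) b) (trans (cong (b ∙_) (∙-comm a b)) (a∙[a∙b]≡b b a))

  ∙-cancelˡ : ∀ a {b c} → a ∙ b ≡ a ∙ c → b ≡ c
  ∙-cancelˡ a {b} {c} eq = trans (sym (a∙[a∙b]≡b a b)) (trans (cong (a ∙_) eq) (a∙[a∙b]≡b a c))

  InRightNucleus : Loop S → Set
  InRightNucleus z = ∀ a b → (a ∙ b) ∙ z ≡ a ∙ (b ∙ z)

  Ω-inRightNucleus : InRightNucleus nothing
  Ω-inRightNucleus a b = trans (∙-identityʳ (a ∙ b)) (cong (a ∙_) (sym (∙-identityʳ b)))

  ∙-inRightNucleus : ∀ {y z} → InRightNucleus y → InRightNucleus z → InRightNucleus (y ∙ z)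
  ∙-inRightNucleus {y} {z} y-nuc z-nuc a b = begin
    (a ∙ b) ∙ (y ∙ z)   ≡⟨ cong ((a ∙ b) ∙_) (∙-comm y z) ⟩
    (a ∙ b) ∙ (z ∙ y)   ≡⟨ y-nuc (a ∙ b) z ⟨
    ((a ∙ b) ∙ z) ∙ y   ≡⟨ cong (_∙ y) (z-nuc a b) ⟩
    (a ∙ (b ∙ z)) ∙ y   ≡⟨ y-nuc a (b ∙ z) ⟩
    a ∙ ((b ∙ z) ∙ y)   ≡⟨ cong (a ∙_) (y-nuc b z) ⟩
    a ∙ (b ∙ (z ∙ y))   ≡⟨ cong (λ w → a ∙ (b ∙ w)) (∙-comm z y) ⟩
    a ∙ (b ∙ (y ∙ z))   ∎
    where open ≡-Reasoning

  inRightNucleus⇒inLeftNucleus : ∀ {h} → InRightNucleus h → ∀ x y → (h ∙ x) ∙ y ≡ h ∙ (x ∙ y)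
  inRightNucleus⇒inLeftNucleus {h} h-nuc x y = begin
    (h ∙ x) ∙ y   ≡⟨ ∙-comm (h ∙ x) y ⟩
    y ∙ (h ∙ x)   ≡⟨ cong (y ∙_) (∙-comm h x) ⟩
    y ∙ (x ∙ h)   ≡⟨ h-nuc y x ⟨
    (y ∙ x) ∙ h   ≡⟨ ∙-comm (y ∙ x) h ⟩
    h ∙ (y ∙ x)   ≡⟨ cong (h ∙_) (∙-comm y x) ⟩
    h ∙ (x ∙ y)   ∎
    where open ≡-Reasoning

  Veblen⇒inRightNucleus : ∀ {x} → Veblen S x → InRightNucleus (just x)
  Veblen⇒inRightNucleus V nothing b = refl
  Veblen⇒inRightNucleus V (just a) nothing = refl
  Veblen⇒inRightNucleus {x} V (just a) (just c) with ≡⊎triple a c | ≡⊎triple c x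
  ... | inj₁ refl | _ =
    trans (cong (_∙ just x) (∙-selfInverse (just a))) (sym (a∙[a∙b]≡b (just a) (just x)))
  ... | inj₂ _ | inj₁ refl =
    trans ([a∙b]∙b≡a (just a) (just x)) (sym (cong (just a ∙_) (∙-selfInverse (just x))))
  ... | inj₂ (y , acy) | inj₂ (p , cxp) = begin
    (just a ∙ just c) ∙ just x   ≡⟨ cong (_∙ just x) (triple⇒∙ acy) ⟩
    just y ∙ just x              ≡⟨ yx≡ap ⟩
    just a ∙ just p              ≡⟨ cong (just a ∙_) (triple⇒∙ cxp) ⟨
    just a ∙ (just c ∙ just x)   ∎
    where
    open ≡-Reasoning
    yx≡ap : just y ∙ just x ≡ just a ∙ just p
    yx≡ap with ≡⊎triple y x
    ... | inj₁ refl = begin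
      just y ∙ just y   ≡⟨ ∙-selfInverse (just y) ⟩
      nothing           ≡⟨ ∙-selfInverse (just a) ⟨
      just a ∙ just a   ≡⟨ cong (λ q → just a ∙ just q) (unique (sym₂₃ (sym₁₂ acy)) cxp) ⟩
      just a ∙ just p   ∎
    -- the Veblen condition at x applied to the lines x c p, x y q and a c y
    ... | inj₂ (q , yxq) =
      trans (triple⇒∙ yxq) (sym (triple⇒∙ (V a c p y q (sym₁₂ cxp) (sym₁₂ yxq) acy)))

  inRightNucleus⇒Veblen : ∀ {x} → InRightNucleus (just x) → Veblen S x
  inRightNucleus⇒Veblen {x} x-nuc y a b c d xab xcd yac = ∙⇒triple (begin
    just y ∙ just b                  ≡⟨ cong₂ _∙_ (triple⇒∙ (sym₂₃ (sym₁₂ yac))) (triple⇒∙ xab) ⟨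
    (A ∙ C) ∙ (X ∙ A)                ≡⟨ cong ((A ∙ C) ∙_) (∙-comm X A) ⟩
    (A ∙ C) ∙ (A ∙ X)                ≡⟨ x-nuc (A ∙ C) A ⟨
    ((A ∙ C) ∙ A) ∙ X                ≡⟨ cong (λ w → (w ∙ A) ∙ X) (∙-comm A C) ⟩
    ((C ∙ A) ∙ A) ∙ X                ≡⟨ cong (_∙ X) ([a∙b]∙b≡a C A) ⟩
    C ∙ X                            ≡⟨ ∙-comm C X ⟩
    X ∙ C                            ≡⟨ triple⇒∙ xcd ⟩
    just d                           ∎)
    where
    open ≡-Reasoning
    A C X : Loop S
    A = just a
    C = just c
    X = just x

  withΩ-Veblen⇔inRightNucleus : ∀ a → withΩ S (Veblen S) a ⇔ InRightNucleus a
  withΩ-Veblen⇔inRightNucleus nothing = mk⇔ (λ _ → Ω-inRightNucleus) (λ _ → tt)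
  withΩ-Veblen⇔inRightNucleus (just x) = mk⇔ Veblen⇒inRightNucleus inRightNucleus⇒Veblen

  Veblen-isSubsystem : IsSubsystem S (Veblen S)
  Veblen-isSubsystem x y z Vx Vy xyz = inRightNucleus⇒Veblen (subst InRightNucleus (triple⇒∙ xyz)
    (∙-inRightNucleus (Veblen⇒inRightNucleus Vx) (Veblen⇒inRightNucleus Vy)))

  coset-cong : ∀ {H : Loop S → Set} {z} {L R : Loop S → Loop S} → (∀ {h} → H h → L h ≡ R h) →
    (∃ λ h → H h × z ≡ L h) ⇔ (∃ λ h → H h × z ≡ R h)
  coset-cong L≡R = mk⇔ (λ (h , Hh , z≡Lh) → h , Hh , trans z≡Lh (L≡R Hh))
                       (λ (h , Hh , z≡Rh) → h , Hh , trans z≡Rh (sym (L≡R Hh)))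

  nuclear-isNormalSubloop : ∀ {H} → IsSubloop S H → (∀ {h} → H h → InRightNucleus h) →
    IsNormalSubloop S H
  nuclear-isNormalSubloop subloop nuclear = subloop , λ x y z →
    coset-cong (λ {h} _ → ∙-comm x h) ,
    coset-cong (λ {h} Hh → sym (nuclear Hh x y)) ,
    coset-cong (λ {h} Hh → inRightNucleus⇒inLeftNucleus (nuclear Hh) x y)

  Veblen-isNormalSubsystem : IsNormalSubsystem S (Veblen S)
  Veblen-isNormalSubsystem = Veblen-isSubsystem , nuclear-isNormalSubloop (tt , closed) nuclear
    where
    open Equivalence
    H : Loop S → Set
    H = withΩ S (Veblen S)
    nuclear : ∀ {a} → H a → InRightNucleus a
    nuclear {a} = to (withΩ-Veblen⇔inRightNucleus a)
    closed : ∀ a b → H a → H b → H (a ∙ b)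
    closed a b Ha Hb =
      from (withΩ-Veblen⇔inRightNucleus (a ∙ b)) (∙-inRightNucleus (nuclear {a} Ha) (nuclear {b} Hb))

  ∙-interchange : ∀ a {b c d} → InRightNucleus b → InRightNucleus c → InRightNucleus d →
    (a ∙ b) ∙ (c ∙ d) ≡ (a ∙ c) ∙ (b ∙ d)
  ∙-interchange a {b} {c} {d} b-nuc c-nuc d-nuc = begin
    (a ∙ b) ∙ (c ∙ d)   ≡⟨ ∙-inRightNucleus c-nuc d-nuc a b ⟩
    a ∙ (b ∙ (c ∙ d))   ≡⟨ cong (a ∙_) (d-nuc b c) ⟨
    a ∙ ((b ∙ c) ∙ d)   ≡⟨ cong (λ w → a ∙ (w ∙ d)) (∙-comm b c) ⟩
    a ∙ ((c ∙ b) ∙ d)   ≡⟨ cong (a ∙_) (d-nuc c b) ⟩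
    a ∙ (c ∙ (b ∙ d))   ≡⟨ ∙-inRightNucleus b-nuc d-nuc a c ⟨
    (a ∙ c) ∙ (b ∙ d)   ∎
    where open ≡-Reasoning

  infixr 8 _⋆_
  _⋆_ : Bool → Loop S → Loop S
  true  ⋆ g = g
  false ⋆ g = nothing

  ⋆-xor : ∀ b c g → (b xor c) ⋆ g ≡ (b ⋆ g) ∙ (c ⋆ g)
  ⋆-xor false c     g = refl
  ⋆-xor true  false g = sym (∙-identityʳ g)
  ⋆-xor true  true  g = sym (∙-selfInverse g)

  ⋆-inRightNucleus : ∀ b {g} → InRightNucleus g → InRightNucleus (b ⋆ g)
  ⋆-inRightNucleus true  g-nuc = g-nuc
  ⋆-inRightNucleus false _     = Ω-inRightNucleus

  combination : ∀ {m} → Vec (Loop S) m → Vec Bool m → Loop S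
  combination []       []      = nothing
  combination (g ∷ gs) (b ∷ u) = (b ⋆ g) ∙ combination gs u

  combination-zero : ∀ {m} (gs : Vec (Loop S) m) → combination gs (replicate m false) ≡ nothing
  combination-zero []       = refl
  combination-zero (g ∷ gs) = combination-zero gs

  combination-inRightNucleus : ∀ {m} {gs : Vec (Loop S) m} → All InRightNucleus gs →
    ∀ u → InRightNucleus (combination gs u)
  combination-inRightNucleus []              []      = Ω-inRightNucleus
  combination-inRightNucleus (g-nuc ∷ gs-nuc) (b ∷ u) =
    ∙-inRightNucleus (⋆-inRightNucleus b g-nuc) (combination-inRightNucleus gs-nuc u)

  combination-xor : ∀ {m} {gs : Vec (Loop S) m} → All InRightNucleus gs →
    ∀ u w → combination gs (zipWith _xor_ u w) ≡ combination gs u ∙ combination gs w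
  combination-xor []              []      []      = refl
  combination-xor {gs = g ∷ gs} (g-nuc ∷ gs-nuc) (b ∷ u) (c ∷ w) = begin
    ((b xor c) ⋆ g) ∙ combination gs (zipWith _xor_ u w)
      ≡⟨ cong₂ _∙_ (⋆-xor b c g) (combination-xor gs-nuc u w) ⟩
    ((b ⋆ g) ∙ (c ⋆ g)) ∙ (U ∙ W)
      ≡⟨ ∙-interchange (b ⋆ g) (⋆-inRightNucleus c g-nuc) U-nuc W-nuc ⟩
    ((b ⋆ g) ∙ U) ∙ ((c ⋆ g) ∙ W)
      ∎
    where
    open ≡-Reasoning
    U W : Loop S
    U = combination gs u
    W = combination gs w
    U-nuc : InRightNucleus U
    U-nuc = combination-inRightNucleus gs-nuc u
    W-nuc : InRightNucleus W
    W-nuc = combination-inRightNucleus gs-nuc w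

  Independent : ∀ {m} → Vec (Loop S) m → Set
  Independent gs = ∀ u w → combination gs u ≡ combination gs w → u ≡ w

  Spans : ∀ {m} → Vec (Loop S) m → Loop S → Set
  Spans gs a = ∃ λ u → combination gs u ≡ a

  translate⇒spans : ∀ {m} {gs : Vec (Loop S) m} {g} → All InRightNucleus gs →
    ∀ u w → g ∙ combination gs u ≡ combination gs w → Spans gs g
  translate⇒spans {gs = gs} {g} gs-nuc u w eq = zipWith _xor_ w u , (begin
    combination gs (zipWith _xor_ w u)   ≡⟨ combination-xor gs-nuc w u ⟩
    W ∙ U                                 ≡⟨ cong (_∙ U) eq ⟨
    (g ∙ U) ∙ U                           ≡⟨ [a∙b]∙b≡a g U ⟩
    g                                     ∎)
    where
    open ≡-Reasoning
    U W : Loop S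
    U = combination gs u
    W = combination gs w

  independent-∷ : ∀ {m} {gs : Vec (Loop S) m} {g} → All InRightNucleus gs → Independent gs →
    ¬ Spans gs g → Independent (g ∷ gs)
  independent-∷ _ independent _ (false ∷ u) (false ∷ w) eq = cong (false ∷_) (independent u w eq)
  independent-∷ {g = g} _ independent _ (true ∷ u) (true ∷ w) eq =
    cong (true ∷_) (independent u w (∙-cancelˡ g eq))
  independent-∷ gs-nuc _ g∉ (true ∷ u) (false ∷ w) eq = ⊥-elim (g∉ (translate⇒spans gs-nuc u w eq))
  independent-∷ gs-nuc _ g∉ (false ∷ u) (true ∷ w) eq =
    ⊥-elim (g∉ (translate⇒spans gs-nuc w u (sym eq)))

  record IndependentNuclearFamily : Set where
    constructor family
    field
      dim : ℕ
      gens : Vec (Loop S) dim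
      gens-inRightNucleus : All InRightNucleus gens
      independent : Independent gens

  open IndependentNuclearFamily

  Veblen? : ∀ x → Dec (Veblen S x)
  Veblen? x = all? λ y → all? λ a → all? λ b → all? λ c → all? λ d →
    triple? x a b →-dec triple? x c d →-dec triple? y a c →-dec triple? y b d
    where
    triple? : ∀ a b c → Dec (IsTriple S a b c)
    triple? a b c = Triple a b c Bool.≟ true

  Spans? : ∀ {m} (gs : Vec (Loop S) m) a → Dec (Spans gs a)
  Spans? gs a = anySubset? λ u → ≡-dec _≟_ (combination gs u) a

  spanningFamily : (xs : List (Fin v)) →
    Σ IndependentNuclearFamily λ F → ∀ {x} → x ∈ xs → Veblen S x → Spans (gens F) (just x)
  spanningFamily [] = family 0 [] [] (λ { [] [] _ → refl }) , λ ()
  spanningFamily (p ∷ xs) with spanningFamily xs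
  ... | F , spans with Veblen? p | Spans? (gens F) (just p)
  ... | no ¬Vp | _ = F , λ { (here refl) Vp → ⊥-elim (¬Vp Vp) ; (there x∈xs) → spans x∈xs }
  ... | yes _ | yes p∈ = F , λ { (here refl) _ → p∈ ; (there x∈xs) → spans x∈xs }
  ... | yes Vp | no p∉ = F′ , λ
    { (here refl) _ → true ∷ replicate (dim F) false , cong (just p ∙_) (combination-zero (gens F))
    ; (there x∈xs) Vx → let (u , eq) = spans x∈xs Vx in false ∷ u , eq
    }
    where
    F′ : IndependentNuclearFamily
    F′ = family (suc (dim F)) (just p ∷ gens F)
      (Veblen⇒inRightNucleus Vp ∷ gens-inRightNucleus F)
      (independent-∷ (gens-inRightNucleus F) (independent F) p∉)

  module _ (F : IndependentNuclearFamily) (spans : ∀ x → Veblen S x → Spans (gens F) (just x)) where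
    private
      comb : Vec Bool (dim F) → Loop S
      comb = combination (gens F)

    point : (p : PGPoint (dim F)) → ∃ λ x → comb (proj₁ p) ≡ just x
    point (u , nz) with comb u in eq
    ... | just x = x , refl
    ... | nothing =
      ⊥-elim (nonzero⇒≢0 u nz (independent F u _ (trans eq (sym (combination-zero (gens F))))))

    embedding : PGPoint (dim F) → Fin v
    embedding = proj₁ ∘ point

    embedding-spec : ∀ p → comb (proj₁ p) ≡ just (embedding p)
    embedding-spec = proj₂ ∘ point

    embedding-injective : ∀ p q → embedding p ≡ embedding q → p ≡ q
    embedding-injective p q eq = PGPoint-≡
      (independent F _ _ (trans (embedding-spec p) (trans (cong just eq) (sym (embedding-spec q)))))

    embedding-∙ : ∀ p q →
      just (embedding p) ∙ just (embedding q) ≡ comb (zipWith _xor_ (proj₁ p) (proj₁ q))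
    embedding-∙ p q = trans (cong₂ _∙_ (sym (embedding-spec p)) (sym (embedding-spec q)))
                            (sym (combination-xor (gens-inRightNucleus F) (proj₁ p) (proj₁ q)))

    Veblen⇔image : ∀ x → Veblen S x ⇔ ∃ λ p → embedding p ≡ x
    Veblen⇔image x = mk⇔ image (λ (p , fp≡x) → subst (Veblen S) fp≡x (Veblen-embedding p))
      where
      Veblen-embedding : ∀ p → Veblen S (embedding p)
      Veblen-embedding p = inRightNucleus⇒Veblen (subst InRightNucleus (embedding-spec p)
        (combination-inRightNucleus (gens-inRightNucleus F) (proj₁ p)))
      image : Veblen S x → ∃ λ p → embedding p ≡ x
      image Vx with spans x Vx
      ... | u , eq = p , just-injective (trans (sym (embedding-spec p)) eq)
        where
        u≢0 : u ≢ replicate (dim F) false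
        u≢0 refl with () ← trans (sym (combination-zero (gens F))) eq
        p : PGPoint (dim F)
        p = u , ≢0⇒nonzero u u≢0

    PGTriple⇔IsTriple : ∀ p q r →
      PGTriple p q r ⇔ IsTriple S (embedding p) (embedding q) (embedding r)
    PGTriple⇔IsTriple p q r = mk⇔
      (λ (_ , r≡p+q) → ∙⇒triple
        (trans (embedding-∙ p q) (trans (cong comb (sym r≡p+q)) (embedding-spec r))))
      (λ pqr → (λ p≡q → proj₁ (distinct pqr) (cong embedding (PGPoint-≡ p≡q))) , independent F _ _
        (trans (embedding-spec r) (trans (sym (triple⇒∙ pqr)) (embedding-∙ p q))))

    spanningFamily⇒isoToPG : IsoToPG S (Veblen S) (dim F)
    spanningFamily⇒isoToPG = embedding , embedding-injective , Veblen⇔image , PGTriple⇔IsTriple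

  Veblen-isoToPG : Σ ℕ (IsoToPG S (Veblen S))
  Veblen-isoToPG =
    let (F , spans) = spanningFamily (allFin v) in
    dim F , spanningFamily⇒isoToPG F (λ x → spans (∈-allFin x))

mainTheorem3 : ∀ {v : ℕ} (S : STS v) →
    IsNormalSubsystem S (Veblen S) ×
    Σ ℕ (λ m → HasOrder (Veblen S) (2 ^ m ∸ 1) × (2 ^ m ∸ 1 ≤ v) × IsoToPG S (Veblen S) m)
mainTheorem3 S with SteinerLoop.Veblen-isoToPG S
... | m , iso = SteinerLoop.Veblen-isNormalSubsystem S , m , order , HasOrder⇒≤ order , iso
  where
  order : HasOrder (Veblen S) (2 ^ m ∸ 1)
  order = IsoToPG⇒HasOrder {S = S} iso
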